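{- Let $T$ be a tournament with a median ordering, and suppose an interval of this ordering is split into consecutive subintervals $A_0\prec A_1\prec\cdots\prec A_t$, each of size $m$. Let $A=A_1\cup\dots\cup A_{t-1}$. Then every vertex $v\in A_0$ has at least $\frac{t-2}{2}m$ outneighbours in $A$, and every vertex $v\in A_t$ has at least $\frac{t-2}{2}m$ inneighbours in $A$.
   Context: A tournament is a complete graph with every edge oriented. A median ordering of a tournament $T$ is an ordering $v_1\prec\dots\prec v_n$ of its vertices maximizing the number of forward edges, i.e. edges oriented $v_i\to v_j$ with $i<j$. An interval is a set $\{v_i,\dots,v_j\}$ of consecutive vertices in this ordering; for vertex sets $X,Y$, $X\prec Y$ means $x\prec y$ for all $x\in X,y\in Y$. -}

module Defs where

open import Data.Nat using (ℕ; zero; suc; _+_; _*_; _<_; _≤_)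
open import Data.Fin using (Fin; toℕ)
open import Data.Bool using (Bool; true; false)
open import Data.List using (List; length; filter; allFin)
open import Data.List.Relation.Unary.Any using ()
open import Data.Product using (_×_)
import Data.Sum
import Data.Product
open import Relation.Binary.PropositionalEquality using (_≡_; _≢_)
open import Relation.Nullary using (¬_)
open import Function.Bundles using (_↔_; Inverse)
open import Relation.Nullary.Decidable using (_×-dec_)
open import Data.Bool.Properties using () renaming (_≟_ to _≟ᵇ_)
open import Data.Nat.Properties using (_<?_; _≤?_)

-- A tournament on vertex set Fin n: adj u v = true means the edge is oriented u → v.
-- No loops, and for distinct u v exactly one orientation.
record Tournament (n : ℕ) : Set where
  field
    adj   : Fin n → Fin n → Bool
    irrefl : ∀ u → adj u u ≡ false
    tourn  : ∀ u v → u ≢ v → (adj u v ≡ true × adj v u ≡ false) Data.Sum.⊎ (adj u v ≡ false × adj v u ≡ true)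
open Tournament public

-- An ordering of the vertices: a bijection from positions to vertices.
-- Position p holds vertex (Inverse.to σ p).
Ordering : ℕ → Set
Ordering n = Fin n ↔ Fin n

forward : ∀ {n} → Tournament n → Ordering n → ℕ
forward {n} T σ =
  length (filter (λ pq → (toℕ (Data.Product.proj₁ pq) <? toℕ (Data.Product.proj₂ pq))
                          ×-dec (adj T (Inverse.to σ (Data.Product.proj₁ pq))
                                       (Inverse.to σ (Data.Product.proj₂ pq)) ≟ᵇ true))
                 (Data.List.cartesianProduct (allFin n) (allFin n)))

IsMedian : ∀ {n} → Tournament n → Ordering n → Set
IsMedian {n} T σ = ∀ (τ : Ordering n) → forward T τ ≤ forward T σ

inRange : ∀ {n} → ℕ → ℕ → Fin n → Set
inRange lo hi p = lo ≤ toℕ p × toℕ p < hi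

outIn : ∀ {n} → Tournament n → Ordering n → Fin n → ℕ → ℕ → ℕ
outIn {n} T σ v lo hi =
  length (filter (λ p → ((lo ≤? toℕ p) ×-dec (toℕ p <? hi))
                         ×-dec (adj T v (Inverse.to σ p) ≟ᵇ true))
                 (allFin n))

inIn : ∀ {n} → Tournament n → Ordering n → Fin n → ℕ → ℕ → ℕ
inIn {n} T σ v lo hi =
  length (filter (λ p → ((lo ≤? toℕ p) ×-dec (toℕ p <? hi))
                         ×-dec (adj T (Inverse.to σ p) v ≟ᵇ true))
                 (allFin n))

-- Carrying a vertex v past the
-- block of vertices between its position and another one, by adjacent transpositions,
-- changes the number of forward edges by (in-neighbours − out-neighbours of v in the block),
-- so v dominates at least half of every block starting right after it and is dominated by
-- at least half of every block ending right before it. For v ∈ A₀ take the block from v to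
-- the end of A_{t−1}: it has at least (t − 1)m + K vertices, only the K < m after v in A₀
-- lying outside A, so v has at least ((t − 1)m + K)/2 − K ≥ (t − 2)m/2 out-neighbours in A.
-- The case v ∈ A_t is symmetric.

module Submission where

open import Defs
open import Data.Nat using (ℕ; _+_; _*_; _∸_; _≤_; _<_)
open import Data.Fin using (Fin; toℕ)
open import Function.Bundles using (Inverse)
import Data.Product

open import Algebra.Properties.CommutativeSemigroup using (x∙yz≈y∙xz)
open import Data.Bool using (Bool; true; false; not; _∧_)
open import Data.Bool.Properties using () renaming (_≟_ to _≟ᵇ_)
open import Data.Empty using (⊥-elim)
open import Data.Fin using (zero; suc; fromℕ<; _≟_)
open import Data.Fin.Permutation using (Permutation; transpose)
import Data.Fin.Permutation.Components as Components
import Data.Fin.Properties as Finₚ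
open import Data.List using (length; filter; tabulate; map; _++_; allFin; cartesianProduct)
open import Data.List.Properties using (filter-++; length-++; map-tabulate)
open import Data.Nat using (zero; suc; z≤n; s≤s; s≤s⁻¹; _≤′_; _<‴_; ≤′-reflexive; ≤′-step; ≤‴-reflexive; ≤‴-step)
open import Data.Nat.Properties hiding (_≟_)
open import Data.Nat.Solver using (module +-*-Solver)
open import Data.Product using (_×_; _,_; proj₁; proj₂; ∃-syntax)
open import Data.Sum using (_⊎_; inj₁; inj₂; [_,_]′)
open import Function using (_∘_; id; mk⇔)
open import Function.Bundles using (Injection)
open import Function.Construct.Composition using (_↔-∘_)
open import Function.Properties.Inverse using (↔⇒↣)
open import Relation.Binary.PropositionalEquality
open import Relation.Nullary using (Dec; yes; no; does; ¬_)
open import Relation.Nullary.Decidable using (dec-true; dec-false; does-⇔; _×-dec_)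
open import Relation.Unary using (Pred; Decidable)
open import Algebra.Properties.CommutativeMonoid.Sum +-0-commutativeMonoid
  using (sum; sum-syntax; sum-cong-≗; sum-replicate-zero; ∑-distrib-+; ∑-permute)

private
  variable
    n lo mid hi : ℕ

+-telescope : ∀ {f₀ f₁ f₂ a b x y} → f₂ + x ≡ f₁ + y → f₁ + a ≡ f₀ + b → f₂ + (a + x) ≡ f₀ + (b + y)
+-telescope {f₀} {f₁} {f₂} {a} {b} {x} {y} f₂+x≡f₁+y f₁+a≡f₀+b = begin
  f₂ + (a + x)  ≡⟨ x∙yz≈y∙xz +-commutativeSemigroup f₂ a x ⟩
  a + (f₂ + x)  ≡⟨ cong (a +_) f₂+x≡f₁+y ⟩
  a + (f₁ + y)  ≡⟨ +-assoc a f₁ y ⟨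
  a + f₁ + y    ≡⟨ cong (_+ y) (trans (+-comm a f₁) f₁+a≡f₀+b) ⟩
  f₀ + b + y    ≡⟨ +-assoc f₀ b y ⟩
  f₀ + (b + y)  ∎
  where open ≡-Reasoning

∸-telescope : ∀ {a b c} → a ≤ b → b ≤ c → c ∸ a ≡ (b ∸ a) + (c ∸ b)
∸-telescope {a} {b} {c} a≤b b≤c = trans (cong (_∸ a) (sym (m+[n∸m]≡n b≤c))) (+-∸-comm (c ∸ b) a≤b)

majority-bound : ∀ {O I K L X} → I ≤ O → O + I ≡ K + L → O ≤ K + X → L ∸ K ≤ 2 * X
majority-bound {O} {I} {K} {L} {X} I≤O O+I≡K+L O≤K+X = m≤n+o⇒m∸n≤o L K (+-cancelˡ-≤ K L (K + 2 * X) (begin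
  K + L              ≡⟨ O+I≡K+L ⟨
  O + I              ≤⟨ +-monoʳ-≤ O I≤O ⟩
  O + O              ≤⟨ +-mono-≤ O≤K+X O≤K+X ⟩
  (K + X) + (K + X)  ≡⟨ solve 2 (λ K X → (K :+ X) :+ (K :+ X) := K :+ (K :+ con 2 :* X)) refl K X ⟩
  K + (K + 2 * X)    ∎))
  where
  open ≤-Reasoning
  open +-*-Solver

block-end : ∀ s t m → s + (t + 1) * m ≡ s + t * m + m
block-end s t m =
  trans (cong (s +_) (trans (*-distribʳ-+ m t 1) (cong (t * m +_) (*-identityˡ m)))) (sym (+-assoc s (t * m) m))

middle-bound : ∀ s t m {K} → K ≤ m → (suc t ∸ 2) * m ≤ (s + suc t * m) ∸ (s + m) ∸ K
middle-bound s t m {K} K≤m = begin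
  (t ∸ 1) * m                    ≡⟨ *-distribʳ-∸ m t 1 ⟩
  t * m ∸ 1 * m                  ≡⟨ cong (t * m ∸_) (*-identityˡ m) ⟩
  t * m ∸ m                      ≤⟨ ∸-monoʳ-≤ (t * m) K≤m ⟩
  t * m ∸ K                      ≡⟨ cong (_∸ K) (trans ([m+n]∸[m+o]≡n∸o s (m + t * m) m) (m+n∸m≡n m (t * m))) ⟨
  (s + suc t * m) ∸ (s + m) ∸ K  ∎
  where open ≤-Reasoning

𝟙 : Bool → ℕ
𝟙 false = 0
𝟙 true  = 1

𝟙-∧ : ∀ a b → 𝟙 (a ∧ b) ≡ 𝟙 a * 𝟙 b
𝟙-∧ false _ = refl
𝟙-∧ true  b = sym (+-identityʳ (𝟙 b))

𝟙-not : ∀ b → 𝟙 b + 𝟙 (not b) ≡ 1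
𝟙-not false = refl
𝟙-not true  = refl

does-≟-true : ∀ b → does (b ≟ᵇ true) ≡ b
does-≟-true false = refl
does-≟-true true  = refl

module _ {a} {A : Set a} where

  𝟙-guard-cong : (d : Dec A) {b c : Bool} → (A → b ≡ c) → 𝟙 (does d ∧ b) ≡ 𝟙 (does d ∧ c)
  𝟙-guard-cong (yes a) b≡c = cong 𝟙 (b≡c a)
  𝟙-guard-cong (no _)  _   = refl

  𝟙-guard-+ : (d : Dec A) {b c : Bool} → (A → 𝟙 b + 𝟙 c ≡ 1) →
    𝟙 (does d ∧ b) + 𝟙 (does d ∧ c) ≡ 𝟙 (does d ∧ true)
  𝟙-guard-+ (yes a) one = one a
  𝟙-guard-+ (no _)  _   = refl

  𝟙-guard-split : ∀ {a₁ a₂} {A₁ : Set a₁} {A₂ : Set a₂} (d : Dec A) (d₁ : Dec A₁) (d₂ : Dec A₂) {b : Bool} →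
    (A₁ → A) → (A₂ → A) → (A → A₁ ⊎ A₂) → (A₁ → ¬ A₂) →
    𝟙 (does d ∧ b) ≡ 𝟙 (does d₁ ∧ b) + 𝟙 (does d₂ ∧ b)
  𝟙-guard-split d (yes a₁) (yes a₂) _ _ _ disjoint = ⊥-elim (disjoint a₁ a₂)
  𝟙-guard-split d (yes a₁) (no _) {b} A₁⇒A _ _ _
    rewrite dec-true d (A₁⇒A a₁) = sym (+-identityʳ (𝟙 b))
  𝟙-guard-split d (no _) (yes a₂) _ A₂⇒A _ _
    rewrite dec-true d (A₂⇒A a₂) = refl
  𝟙-guard-split d (no ¬a₁) (no ¬a₂) _ _ cover _
    rewrite dec-false d ([ ¬a₁ , ¬a₂ ]′ ∘ cover) = refl

∑-zero : (f : Fin n → ℕ) → (∀ i → f i ≡ 0) → ∑[ i < n ] f i ≡ 0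
∑-zero {n} f f≗0 = trans (sum-cong-≗ f≗0) (sum-replicate-zero n)

∑-supported : (f : Fin n → ℕ) (i : Fin n) → (∀ j → j ≢ i → f j ≡ 0) → ∑[ j < n ] f j ≡ f i
∑-supported f zero    f≗0 =
  trans (cong (f zero +_) (∑-zero (f ∘ suc) (λ j → f≗0 (suc j) λ ()))) (+-identityʳ (f zero))
∑-supported f (suc i) f≗0 =
  cong₂ _+_ (f≗0 zero λ ()) (∑-supported (f ∘ suc) i (λ j j≢i → f≗0 (suc j) (j≢i ∘ Finₚ.suc-injective)))

∑∑ : (Fin n → Fin n → ℕ) → ℕ
∑∑ {n} f = ∑[ p < n ] ∑[ q < n ] f p q

∑∑-cong : ∀ {f g : Fin n → Fin n → ℕ} → (∀ p q → f p q ≡ g p q) → ∑∑ f ≡ ∑∑ g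
∑∑-cong f≗g = sum-cong-≗ λ p → sum-cong-≗ (f≗g p)

∑∑-distrib-+ : (f g : Fin n → Fin n → ℕ) → ∑∑ (λ p q → f p q + g p q) ≡ ∑∑ f + ∑∑ g
∑∑-distrib-+ {n} f g = trans (sum-cong-≗ λ p → ∑-distrib-+ (f p) (g p)) (∑-distrib-+ {n} _ _)

δ : Fin n → Fin n → Fin n → Fin n → ℕ
δ a b p q = 𝟙 (does (p ≟ a)) * 𝟙 (does (q ≟ b))

δ-off : ∀ {a b p q : Fin n} → p ≢ a ⊎ q ≢ b → δ a b p q ≡ 0
δ-off {a = a} {p = p} (inj₁ p≢a) rewrite dec-false (p ≟ a) p≢a = refl
δ-off {a = a} {b} {p} {q} (inj₂ q≢b) rewrite dec-false (q ≟ b) q≢b = *-zeroʳ (𝟙 (does (p ≟ a)))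

δ-on : (a b : Fin n) → δ a b a b ≡ 1
δ-on a b rewrite dec-true (a ≟ a) refl | dec-true (b ≟ b) refl = refl

∑∑-δ : (a b : Fin n) (f : Fin n → Fin n → ℕ) → ∑∑ (λ p q → δ a b p q * f p q) ≡ f a b
∑∑-δ {n} a b f =
  trans (∑-supported _ a λ p p≢a → ∑-zero {n} _ λ q → cong (_* f p q) (δ-off {b = b} {q = q} (inj₁ p≢a)))
        (trans (∑-supported _ b λ q q≢b → cong (_* f a q) (δ-off {a = a} {p = a} (inj₂ q≢b)))
               (trans (cong (_* f a b) (δ-on a b)) (*-identityˡ (f a b))))

module _ {a p} {A : Set a} {P : Pred A p} (P? : Decidable P) where

  length-filter-tabulate : ∀ {n} (f : Fin n → A) →
    length (filter P? (tabulate f)) ≡ ∑[ i < n ] 𝟙 (does (P? (f i)))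
  length-filter-tabulate {zero}  f = refl
  length-filter-tabulate {suc n} f with does (P? (f zero))
  ... | true  = cong suc (length-filter-tabulate (f ∘ suc))
  ... | false = length-filter-tabulate (f ∘ suc)

module _ {a b p} {A : Set a} {B : Set b} {P : Pred (A × B) p} (P? : Decidable P) where

  length-filter-cartesianProduct : ∀ {m n} (f : Fin m → A) (g : Fin n → B) →
    length (filter P? (cartesianProduct (tabulate f) (tabulate g)))
      ≡ ∑[ i < m ] ∑[ j < n ] 𝟙 (does (P? (f i , g j)))
  length-filter-cartesianProduct {zero}  f g = refl
  length-filter-cartesianProduct {suc m} f g = begin
    length (filter P? (row ++ rest))                  ≡⟨ cong length (filter-++ P? row rest) ⟩
    length (filter P? row ++ filter P? rest)          ≡⟨ length-++ (filter P? row) ⟩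
    length (filter P? row) + length (filter P? rest)  ≡⟨ cong₂ _+_ first-row other-rows ⟩
    _                                                 ∎
    where
    open ≡-Reasoning
    row  = map (f zero ,_) (tabulate g)
    rest = cartesianProduct (tabulate (f ∘ suc)) (tabulate g)
    first-row = trans (cong (length ∘ filter P?) (map-tabulate g (f zero ,_)))
                      (length-filter-tabulate P? (λ j → f zero , g j))
    other-rows = length-filter-cartesianProduct (f ∘ suc) g

inRange? : ∀ lo hi (p : Fin n) → Dec (inRange lo hi p)
inRange? lo hi p = (lo ≤? toℕ p) ×-dec (toℕ p <? hi)

-- Shaped like outIn and inIn, so that outIn T σ v lo hi is countIn lo hi (adj T v ∘ to σ) by definition.
countIn : ℕ → ℕ → (Fin n → Bool) → ℕ
countIn {n} lo hi Q = length (filter (λ p → inRange? lo hi p ×-dec (Q p ≟ᵇ true)) (allFin n))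

countIn-as-∑ : ∀ lo hi (Q : Fin n → Bool) → countIn lo hi Q ≡ ∑[ p < n ] 𝟙 (does (inRange? lo hi p) ∧ Q p)
countIn-as-∑ {n} lo hi Q = trans (length-filter-tabulate _ {n} id)
  (sum-cong-≗ λ p → cong (λ b → 𝟙 (does (inRange? lo hi p) ∧ b)) (does-≟-true (Q p)))

module _ (Q : Fin n → Bool) where

  countIn-cong : ∀ {Q′} → (∀ p → inRange lo hi p → Q p ≡ Q′ p) → countIn lo hi Q ≡ countIn lo hi Q′
  countIn-cong {lo = lo} {hi = hi} {Q′} Q≗Q′ =
    trans (countIn-as-∑ lo hi Q) (trans (sum-cong-≗ {n} agree) (sym (countIn-as-∑ lo hi Q′)))
    where
    agree : ∀ p → 𝟙 (does (inRange? lo hi p) ∧ Q p) ≡ 𝟙 (does (inRange? lo hi p) ∧ Q′ p)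
    agree p = 𝟙-guard-cong (inRange? lo hi p) (Q≗Q′ p)

  countIn-empty : hi ≤ lo → countIn lo hi Q ≡ 0
  countIn-empty {hi = hi} {lo = lo} hi≤lo = trans (countIn-as-∑ lo hi Q) (∑-zero _ λ p →
    cong (λ b → 𝟙 (b ∧ Q p)) (dec-false (inRange? lo hi p) λ (lo≤p , p<hi) → <⇒≱ (<-≤-trans p<hi hi≤lo) lo≤p))

  countIn-split : lo ≤ mid → mid ≤ hi → countIn lo hi Q ≡ countIn lo mid Q + countIn mid hi Q
  countIn-split {lo = lo} {mid = mid} {hi = hi} lo≤mid mid≤hi =
    trans (countIn-as-∑ lo hi Q) (trans (sum-cong-≗ pieces) (trans (∑-distrib-+ {n} _ _)
      (sym (cong₂ _+_ (countIn-as-∑ lo mid Q) (countIn-as-∑ mid hi Q)))))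
    where
    pieces : ∀ p → 𝟙 (does (inRange? lo hi p) ∧ Q p)
                 ≡ 𝟙 (does (inRange? lo mid p) ∧ Q p) + 𝟙 (does (inRange? mid hi p) ∧ Q p)
    pieces p = 𝟙-guard-split (inRange? lo hi p) (inRange? lo mid p) (inRange? mid hi p)
      (λ (lo≤p , p<mid) → lo≤p , <-≤-trans p<mid mid≤hi)
      (λ (mid≤p , p<hi) → ≤-trans lo≤mid mid≤p , p<hi)
      (λ (lo≤p , p<hi) → [ (λ mid≤p → inj₂ (mid≤p , p<hi)) , (λ p<mid → inj₁ (lo≤p , p<mid)) ]′
                                (≤-<-connex mid (toℕ p)))
      (λ (_ , p<mid) (mid≤p , _) → <⇒≱ p<mid mid≤p)

  countIn-singleton : (p : Fin n) → countIn (toℕ p) (suc (toℕ p)) Q ≡ 𝟙 (Q p)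
  countIn-singleton p = trans (countIn-as-∑ (toℕ p) (suc (toℕ p)) Q) (trans (∑-supported _ p elsewhere) here)
    where
    elsewhere : ∀ q → q ≢ p → 𝟙 (does (inRange? (toℕ p) (suc (toℕ p)) q) ∧ Q q) ≡ 0
    elsewhere q q≢p rewrite dec-false (inRange? (toℕ p) (suc (toℕ p)) q)
      (λ (p≤q , q<1+p) → q≢p (Finₚ.toℕ-injective (≤-antisym (s≤s⁻¹ q<1+p) p≤q))) = refl
    here : 𝟙 (does (inRange? (toℕ p) (suc (toℕ p)) p) ∧ Q p) ≡ 𝟙 (Q p)
    here rewrite dec-true (inRange? (toℕ p) (suc (toℕ p)) p) (≤-refl , ≤-refl) = refl

  countIn-uncons : (p : Fin n) → toℕ p ≡ lo → lo < hi → countIn lo hi Q ≡ 𝟙 (Q p) + countIn (suc lo) hi Q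
  countIn-uncons {hi = hi} p refl p<hi =
    trans (countIn-split (n≤1+n _) p<hi) (cong (_+ countIn (suc (toℕ p)) hi Q) (countIn-singleton p))

  countIn-unsnoc : (p : Fin n) → toℕ p ≡ hi → lo ≤ hi → countIn lo (suc hi) Q ≡ 𝟙 (Q p) + countIn lo hi Q
  countIn-unsnoc {lo = lo} p refl lo≤p =
    trans (countIn-split lo≤p (n≤1+n _)) (trans (+-comm (countIn lo (toℕ p) Q) _)
      (cong (_+ countIn lo (toℕ p) Q) (countIn-singleton p)))

countIn-all : lo ≤ hi → hi ≤ n → countIn lo hi (λ (_ : Fin n) → true) ≡ hi ∸ lo
countIn-all {lo = lo} {n = n} lo≤hi hi≤n with m≤n⇒∃[o]m+o≡n lo≤hi
... | d , refl = trans (initial-segment d hi≤n) (sym (m+n∸m≡n lo d))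
  where
  everything : Fin n → Bool
  everything _ = true
  initial-segment : ∀ d → lo + d ≤ n → countIn lo (lo + d) everything ≡ d
  initial-segment zero    _  = countIn-empty everything (≤-reflexive (+-identityʳ lo))
  initial-segment (suc d) le = begin
    countIn lo (lo + suc d) everything    ≡⟨ cong (λ h → countIn lo h everything) (+-suc lo d) ⟩
    countIn lo (suc (lo + d)) everything
      ≡⟨ countIn-unsnoc everything (fromℕ< lo+d<n) (Finₚ.toℕ-fromℕ< lo+d<n) (m≤m+n lo d) ⟩
    suc (countIn lo (lo + d) everything)  ≡⟨ cong suc (initial-segment d (<⇒≤ lo+d<n)) ⟩
    suc d                                 ∎
    where
    open ≡-Reasoning
    lo+d<n = subst (_≤ n) (+-suc lo d) le

countIn-complement : ∀ {Q Q′ : Fin n → Bool} → lo ≤ hi → hi ≤ n →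
  (∀ p → inRange lo hi p → 𝟙 (Q p) + 𝟙 (Q′ p) ≡ 1) → countIn lo hi Q + countIn lo hi Q′ ≡ hi ∸ lo
countIn-complement {n = n} {lo = lo} {hi = hi} {Q} {Q′} lo≤hi hi≤n exactly-one = begin
  countIn lo hi Q + countIn lo hi Q′          ≡⟨ cong₂ _+_ (countIn-as-∑ lo hi Q) (countIn-as-∑ lo hi Q′) ⟩
  ∑[ p < n ] 𝟙 (in? p ∧ Q p) + ∑[ p < n ] 𝟙 (in? p ∧ Q′ p)
                                              ≡⟨ ∑-distrib-+ {n} _ _ ⟨
  ∑[ p < n ] (𝟙 (in? p ∧ Q p) + 𝟙 (in? p ∧ Q′ p))
                                              ≡⟨ sum-cong-≗ one-in-range ⟩
  ∑[ p < n ] 𝟙 (in? p ∧ true)                 ≡⟨ countIn-as-∑ lo hi (λ (_ : Fin n) → true) ⟨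
  countIn lo hi (λ (_ : Fin n) → true)        ≡⟨ countIn-all lo≤hi hi≤n ⟩
  hi ∸ lo                                     ∎
  where
  open ≡-Reasoning
  in? : Fin n → Bool
  in? p = does (inRange? lo hi p)
  one-in-range : ∀ p → 𝟙 (in? p ∧ Q p) + 𝟙 (in? p ∧ Q′ p) ≡ 𝟙 (in? p ∧ true)
  one-in-range p = 𝟙-guard-+ (inRange? lo hi p) (exactly-one p)

countIn≤hi∸lo : ∀ {Q : Fin n → Bool} → lo ≤ hi → hi ≤ n → countIn lo hi Q ≤ hi ∸ lo
countIn≤hi∸lo {lo = lo} {hi = hi} {Q = Q} lo≤hi hi≤n =
  ≤-trans (m≤m+n (countIn lo hi Q) _) (≤-reflexive (countIn-complement {Q′ = not ∘ Q} lo≤hi hi≤n λ p _ → 𝟙-not (Q p)))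

transpose-matchˡ : (i j : Fin n) → Components.transpose i j i ≡ j
transpose-matchˡ i j rewrite dec-true (i ≟ i) refl = refl

transpose-matchʳ : (i j : Fin n) → Components.transpose i j j ≡ i
transpose-matchʳ i j with j ≟ i
... | yes j≡i = j≡i
... | no  _   rewrite dec-true (j ≟ j) refl = refl

transpose-other : ∀ {i j k : Fin n} → k ≢ i → k ≢ j → Components.transpose i j k ≡ k
transpose-other {i = i} {j} {k} k≢i k≢j rewrite dec-false (k ≟ i) k≢i | dec-false (k ≟ j) k≢j = refl

before : Fin n → Fin n → ℕ
before p q = 𝟙 (does (toℕ p <? toℕ q))

before-irrefl : (p : Fin n) → before p p ≡ 0
before-irrefl p = cong 𝟙 (dec-false (toℕ p <? toℕ p) (<-irrefl refl))

module _ {j j′ : Fin n} (j′≡1+j : toℕ j′ ≡ suc (toℕ j)) where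

  private
    τ : Fin n → Fin n
    τ = Components.transpose j′ j

    j<j′ : toℕ j < toℕ j′
    j<j′ = ≤-reflexive (sym j′≡1+j)

    j≢j′ : j ≢ j′
    j≢j′ j≡j′ = <-irrefl (cong toℕ j≡j′) j<j′

    before-j-j′ : before j j′ ≡ 1
    before-j-j′ = cong 𝟙 (dec-true (toℕ j <? toℕ j′) j<j′)

    before-j′-j : before j′ j ≡ 0
    before-j′-j = cong 𝟙 (dec-false (toℕ j′ <? toℕ j) (<⇒≯ j<j′))

    before-awayˡ : ∀ {x} → x ≢ j → x ≢ j′ → before j x ≡ before j′ x
    before-awayˡ {x} x≢j x≢j′ =
      cong 𝟙 (does-⇔ (mk⇔ j<x⇒j′<x (<-trans j<j′)) (toℕ j <? toℕ x) (toℕ j′ <? toℕ x))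
      where
      j<x⇒j′<x : toℕ j < toℕ x → toℕ j′ < toℕ x
      j<x⇒j′<x j<x = ≤∧≢⇒< (subst (_≤ toℕ x) (sym j′≡1+j) j<x) (x≢j′ ∘ Finₚ.toℕ-injective ∘ sym)

    before-awayʳ : ∀ {x} → x ≢ j → x ≢ j′ → before x j ≡ before x j′
    before-awayʳ {x} x≢j x≢j′ =
      cong 𝟙 (does-⇔ (mk⇔ (λ x<j → <-trans x<j j<j′) x<j′⇒x<j) (toℕ x <? toℕ j) (toℕ x <? toℕ j′))
      where
      x<j′⇒x<j : toℕ x < toℕ j′ → toℕ x < toℕ j
      x<j′⇒x<j x<j′ = ≤∧≢⇒< (s≤s⁻¹ (subst (toℕ x <_) j′≡1+j x<j′)) (x≢j ∘ Finₚ.toℕ-injective)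

    data Site (x : Fin n) : Set where
      at-j  : x ≡ j → Site x
      at-j′ : x ≡ j′ → Site x
      away  : x ≢ j → x ≢ j′ → Site x

    site : ∀ x → Site x
    site x with x ≟ j | x ≟ j′
    ... | yes x≡j | _        = at-j x≡j
    ... | no  _   | yes x≡j′ = at-j′ x≡j′
    ... | no x≢j  | no x≢j′  = away x≢j x≢j′

    unchanged : ∀ p q → before (τ p) (τ q) ≡ before p q → p ≢ j ⊎ q ≢ j′ → p ≢ j′ ⊎ q ≢ j →
      before (τ p) (τ q) + δ j j′ p q ≡ before p q + δ j′ j p q
    unchanged _ _ b d d′ = cong₂ _+_ b (trans (δ-off d) (sym (δ-off d′)))

  -- Transposing adjacent positions reverses the order of j and j′ and of no other pair.
  before-transpose : ∀ p q → before (τ p) (τ q) + δ j j′ p q ≡ before p q + δ j′ j p q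
  before-transpose p q with site p | site q
  ... | at-j refl | at-j refl =
    unchanged j j (trans (before-irrefl (τ j)) (sym (before-irrefl j))) (inj₂ j≢j′) (inj₁ j≢j′)
  ... | at-j′ refl | at-j′ refl =
    unchanged j′ j′ (trans (before-irrefl (τ j′)) (sym (before-irrefl j′))) (inj₁ (≢-sym j≢j′)) (inj₂ (≢-sym j≢j′))
  ... | at-j refl | at-j′ refl =
    trans (cong₂ _+_ (trans (cong₂ before (transpose-matchʳ j′ j) (transpose-matchˡ j′ j)) before-j′-j) (δ-on j j′))
          (sym (cong₂ _+_ before-j-j′ (δ-off {b = j} {q = j′} (inj₁ j≢j′))))
  ... | at-j′ refl | at-j refl =
    trans (cong₂ _+_ (trans (cong₂ before (transpose-matchˡ j′ j) (transpose-matchʳ j′ j)) before-j-j′)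
                     (δ-off {b = j′} {q = j} (inj₁ (≢-sym j≢j′))))
          (sym (cong₂ _+_ before-j′-j (δ-on j′ j)))
  ... | at-j refl | away q≢j q≢j′ =
    unchanged j q (trans (cong₂ before (transpose-matchʳ j′ j) (transpose-other q≢j′ q≢j)) (sym (before-awayˡ q≢j q≢j′)))
              (inj₂ q≢j′) (inj₂ q≢j)
  ... | at-j′ refl | away q≢j q≢j′ =
    unchanged j′ q (trans (cong₂ before (transpose-matchˡ j′ j) (transpose-other q≢j′ q≢j)) (before-awayˡ q≢j q≢j′))
              (inj₁ (≢-sym j≢j′)) (inj₂ q≢j)
  ... | away p≢j p≢j′ | at-j refl =
    unchanged p j (trans (cong₂ before (transpose-other p≢j′ p≢j) (transpose-matchʳ j′ j)) (sym (before-awayʳ p≢j p≢j′)))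
              (inj₁ p≢j) (inj₁ p≢j′)
  ... | away p≢j p≢j′ | at-j′ refl =
    unchanged p j′ (trans (cong₂ before (transpose-other p≢j′ p≢j) (transpose-matchˡ j′ j)) (before-awayʳ p≢j p≢j′))
              (inj₁ p≢j) (inj₁ p≢j′)
  ... | away p≢j p≢j′ | away q≢j q≢j′ =
    unchanged p q (cong₂ before (transpose-other p≢j′ p≢j) (transpose-other q≢j′ q≢j)) (inj₁ p≢j) (inj₁ p≢j′)

countIn-transpose : (σ : Ordering n) {j j′ : Fin n} (F : Fin n → Bool) → ¬ inRange lo hi j → ¬ inRange lo hi j′ →
  countIn lo hi (F ∘ Inverse.to (σ ↔-∘ transpose j j′)) ≡ countIn lo hi (F ∘ Inverse.to σ)
countIn-transpose σ F j∉ j′∉ = countIn-cong (F ∘ Inverse.to (σ ↔-∘ transpose _ _)) λ q q∈ →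
  cong (F ∘ Inverse.to σ) (transpose-other (λ { refl → j∉ q∈ }) (λ { refl → j′∉ q∈ }))

module _ (T : Tournament n) where

  edge : Ordering n → Fin n → Fin n → ℕ
  edge σ p q = 𝟙 (adj T (Inverse.to σ p) (Inverse.to σ q))

  forward-as-∑ : (σ : Ordering n) → forward T σ ≡ ∑∑ (λ p q → before p q * edge σ p q)
  forward-as-∑ σ = trans (length-filter-cartesianProduct forward? {n} {n} id id) (∑∑-cong λ p q →
    trans (𝟙-∧ (does (toℕ p <? toℕ q)) _) (cong (λ b → before p q * 𝟙 b) (does-≟-true (arc p q))))
    where
    arc : Fin n → Fin n → Bool
    arc p q = adj T (Inverse.to σ p) (Inverse.to σ q)
    forward? : (pq : Fin n × Fin n) → Dec (toℕ (proj₁ pq) < toℕ (proj₂ pq) × arc (proj₁ pq) (proj₂ pq) ≡ true)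
    forward? (p , q) = (toℕ p <? toℕ q) ×-dec (arc p q ≟ᵇ true)

  forward-∘ : (σ : Ordering n) (π : Permutation n n) →
    forward T (σ ↔-∘ π) ≡ ∑∑ (λ p q → before (Inverse.from π p) (Inverse.from π q) * edge σ p q)
  forward-∘ σ π = sym (begin
    ∑∑ (λ p q → before (from p) (from q) * edge σ p q)
      ≡⟨ ∑-permute (λ p → ∑[ q < n ] (before (from p) (from q) * edge σ p q)) π ⟩
    ∑[ p < n ] ∑[ q < n ] (before (from (to p)) (from q) * edge σ (to p) q)
      ≡⟨ sum-cong-≗ (λ p → ∑-permute (λ q → before (from (to p)) (from q) * edge σ (to p) q) π) ⟩
    ∑∑ (λ p q → before (from (to p)) (from (to q)) * edge σ (to p) (to q))
      ≡⟨ ∑∑-cong (λ p q → cong₂ (λ x y → before x y * edge σ (to p) (to q))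
                                (strictlyInverseʳ p) (strictlyInverseʳ q)) ⟩
    ∑∑ (λ p q → before p q * edge (σ ↔-∘ π) p q)
      ≡⟨ forward-as-∑ (σ ↔-∘ π) ⟨
    forward T (σ ↔-∘ π) ∎)
    where
    open ≡-Reasoning
    open Inverse π

  forward-transpose : (σ : Ordering n) {j j′ : Fin n} → toℕ j′ ≡ suc (toℕ j) →
    forward T (σ ↔-∘ transpose j j′) + edge σ j j′ ≡ forward T σ + edge σ j′ j
  forward-transpose σ {j} {j′} j′≡1+j = begin
    forward T (σ ↔-∘ transpose j j′) + edge σ j j′
      ≡⟨ cong₂ _+_ (forward-∘ σ (transpose j j′)) (sym (∑∑-δ j j′ (edge σ))) ⟩
    ∑∑ (λ p q → before (τ p) (τ q) * edge σ p q) + ∑∑ (λ p q → δ j j′ p q * edge σ p q)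
      ≡⟨ ∑∑-distrib-+ (λ p q → before (τ p) (τ q) * edge σ p q) (λ p q → δ j j′ p q * edge σ p q) ⟨
    ∑∑ (λ p q → before (τ p) (τ q) * edge σ p q + δ j j′ p q * edge σ p q)
      ≡⟨ ∑∑-cong exchange ⟩
    ∑∑ (λ p q → before p q * edge σ p q + δ j′ j p q * edge σ p q)
      ≡⟨ ∑∑-distrib-+ (λ p q → before p q * edge σ p q) (λ p q → δ j′ j p q * edge σ p q) ⟩
    ∑∑ (λ p q → before p q * edge σ p q) + ∑∑ (λ p q → δ j′ j p q * edge σ p q)
      ≡⟨ cong₂ _+_ (sym (forward-as-∑ σ)) (∑∑-δ j′ j (edge σ)) ⟩
    forward T σ + edge σ j′ j ∎
    where
    open ≡-Reasoning
    τ = Components.transpose j′ j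
    exchange : ∀ p q → before (τ p) (τ q) * edge σ p q + δ j j′ p q * edge σ p q
                     ≡ before p q * edge σ p q + δ j′ j p q * edge σ p q
    exchange p q = begin
      before (τ p) (τ q) * edge σ p q + δ j j′ p q * edge σ p q
        ≡⟨ *-distribʳ-+ (edge σ p q) (before (τ p) (τ q)) (δ j j′ p q) ⟨
      (before (τ p) (τ q) + δ j j′ p q) * edge σ p q
        ≡⟨ cong (_* edge σ p q) (before-transpose j′≡1+j p q) ⟩
      (before p q + δ j′ j p q) * edge σ p q
        ≡⟨ *-distribʳ-+ (edge σ p q) (before p q) (δ j′ j p q) ⟩
      before p q * edge σ p q + δ j′ j p q * edge σ p q  ∎

  -- τ carries v from position i to hi - 1, shifting the vertices in between one step left.
  -- The position is passed as i with toℕ p ≡ i so that the recursion can split i <‴ hi.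
  move-right : (σ : Ordering n) {v : Fin n} {i : ℕ} (p : Fin n) →
    Inverse.to σ p ≡ v → toℕ p ≡ i → hi ≤ n → i <‴ hi →
    ∃[ τ ] forward T τ + outIn T σ v (suc i) hi ≡ forward T σ + inIn T σ v (suc i) hi
  move-right σ p refl refl _ (≤‴-reflexive refl) =
    σ , cong (forward T σ +_) (trans (countIn-empty (adj T v ∘ to σ) ≤-refl)
                                     (sym (countIn-empty ((λ u → adj T u v) ∘ to σ) ≤-refl)))
    where
    open Inverse using (to)
    v = to σ p
  move-right {hi = hi} σ p refl refl hi≤n (≤‴-step 1+p<‴hi) = τ , (begin
    forward T τ + outIn T σ v (suc i) hi
      ≡⟨ cong (forward T τ +_) (countIn-uncons (adj T v ∘ to σ) p′ p′≡1+i 1+i<hi) ⟩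
    forward T τ + (edge σ p p′ + outIn T σ v (suc (suc i)) hi)
      ≡⟨ +-telescope {forward T σ} {forward T σ′} {forward T τ} shifted (forward-transpose σ p′≡1+i) ⟩
    forward T σ + (edge σ p′ p + inIn T σ v (suc (suc i)) hi)
      ≡⟨ cong (forward T σ +_) (countIn-uncons ((λ u → adj T u v) ∘ to σ) p′ p′≡1+i 1+i<hi) ⟨
    forward T σ + inIn T σ v (suc i) hi ∎)
    where
    open ≡-Reasoning
    open Inverse using (to)
    i = toℕ p
    v = to σ p
    1+i<hi : suc i < hi
    1+i<hi = ≤‴⇒≤ 1+p<‴hi
    p′ : Fin n
    p′ = fromℕ< (<-≤-trans 1+i<hi hi≤n)
    p′≡1+i : toℕ p′ ≡ suc i
    p′≡1+i = Finₚ.toℕ-fromℕ< _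
    σ′ = σ ↔-∘ transpose p p′
    before-range : ∀ {x} → toℕ x ≤ suc i → ¬ inRange (suc (suc i)) hi x
    before-range x≤1+i (2+i≤x , _) = <⇒≱ (s≤s x≤1+i) 2+i≤x
    agree : (F : Fin n → Bool) → countIn (suc (suc i)) hi (F ∘ to σ′) ≡ countIn (suc (suc i)) hi (F ∘ to σ)
    agree F = countIn-transpose σ F (before-range (n≤1+n i)) (before-range (≤-reflexive p′≡1+i))
    recursive = move-right σ′ p′ (cong (to σ) (transpose-matchʳ p p′)) p′≡1+i hi≤n 1+p<‴hi
    τ = proj₁ recursive
    shifted : forward T τ + outIn T σ v (suc (suc i)) hi ≡ forward T σ′ + inIn T σ v (suc (suc i)) hi
    shifted = trans (cong (forward T τ +_) (sym (agree (adj T v))))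
                    (trans (proj₂ recursive) (cong (forward T σ′ +_) (agree (λ u → adj T u v))))

  -- τ carries v from position k down to lo, shifting the vertices in between one step right.
  move-left : (σ : Ordering n) {v : Fin n} {k : ℕ} (p : Fin n) →
    Inverse.to σ p ≡ v → toℕ p ≡ k → lo ≤′ k →
    ∃[ τ ] forward T τ + inIn T σ v lo k ≡ forward T σ + outIn T σ v lo k
  move-left σ p refl _ (≤′-reflexive refl) =
    σ , cong (forward T σ +_) (trans (countIn-empty ((λ u → adj T u v) ∘ to σ) ≤-refl)
                                     (sym (countIn-empty (adj T v ∘ to σ) ≤-refl)))
    where
    open Inverse using (to)
    v = to σ p
  move-left {lo = lo} σ p refl p≡1+k (≤′-step {k} lo≤′k) = τ , (begin
    forward T τ + inIn T σ v lo (suc k)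
      ≡⟨ cong (forward T τ +_) (countIn-unsnoc ((λ u → adj T u v) ∘ to σ) p′ p′≡k lo≤k) ⟩
    forward T τ + (edge σ p′ p + inIn T σ v lo k)
      ≡⟨ +-telescope {forward T σ} {forward T σ′} {forward T τ} shifted (forward-transpose σ p≡1+p′) ⟩
    forward T σ + (edge σ p p′ + outIn T σ v lo k)
      ≡⟨ cong (forward T σ +_) (countIn-unsnoc (adj T v ∘ to σ) p′ p′≡k lo≤k) ⟨
    forward T σ + outIn T σ v lo (suc k) ∎)
    where
    open ≡-Reasoning
    open Inverse using (to)
    v = to σ p
    lo≤k : lo ≤ k
    lo≤k = ≤′⇒≤ lo≤′k
    p′ : Fin n
    p′ = fromℕ< (subst (_≤ n) p≡1+k (<⇒≤ (Finₚ.toℕ<n p)))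
    p′≡k : toℕ p′ ≡ k
    p′≡k = Finₚ.toℕ-fromℕ< _
    p≡1+p′ : toℕ p ≡ suc (toℕ p′)
    p≡1+p′ = trans p≡1+k (cong suc (sym p′≡k))
    σ′ = σ ↔-∘ transpose p′ p
    after-range : ∀ {x} → k ≤ toℕ x → ¬ inRange lo k x
    after-range k≤x (_ , x<k) = <⇒≱ x<k k≤x
    agree : (F : Fin n → Bool) → countIn lo k (F ∘ to σ′) ≡ countIn lo k (F ∘ to σ)
    agree F = countIn-transpose σ F (after-range (≤-reflexive (sym p′≡k)))
                                    (after-range (≤-trans (n≤1+n k) (≤-reflexive (sym p≡1+k))))
    recursive = move-left σ′ p′ (cong (to σ) (transpose-matchˡ p′ p)) p′≡k lo≤′k
    τ = proj₁ recursive
    shifted : forward T τ + inIn T σ v lo k ≡ forward T σ′ + outIn T σ v lo k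
    shifted = trans (cong (forward T τ +_) (sym (agree (λ u → adj T u v))))
                    (trans (proj₂ recursive) (cong (forward T σ′ +_) (agree (adj T v))))

  median-exchange : (σ : Ordering n) → IsMedian T σ → ∀ τ {x y} → forward T τ + x ≡ forward T σ + y → y ≤ x
  median-exchange σ median τ {x} {y} τ+x≡σ+y =
    +-cancelˡ-≤ (forward T σ) y x (≤-trans (≤-reflexive (sym τ+x≡σ+y)) (+-monoˡ-≤ x (median τ)))

  𝟙-adj-exclusive : ∀ {u w} → u ≢ w → 𝟙 (adj T u w) + 𝟙 (adj T w u) ≡ 1
  𝟙-adj-exclusive u≢w with tourn T _ _ u≢w
  ... | inj₁ (uw , wu) rewrite uw | wu = refl
  ... | inj₂ (uw , wu) rewrite uw | wu = refl

  outIn+inIn≡hi∸lo : (σ : Ordering n) (p : Fin n) → ¬ inRange lo hi p → lo ≤ hi → hi ≤ n →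
    outIn T σ (Inverse.to σ p) lo hi + inIn T σ (Inverse.to σ p) lo hi ≡ hi ∸ lo
  outIn+inIn≡hi∸lo σ p p∉ lo≤hi hi≤n = countIn-complement lo≤hi hi≤n λ q q∈ →
    𝟙-adj-exclusive λ σp≡σq → p∉ (subst (inRange _ _) (sym (Injection.injective (↔⇒↣ σ) σp≡σq)) q∈)

  out-degree-bound : (σ : Ordering n) → IsMedian T σ → (p : Fin n) → toℕ p < lo → lo ≤ hi → hi ≤ n →
    (hi ∸ lo) ∸ (lo ∸ suc (toℕ p)) ≤ 2 * outIn T σ (Inverse.to σ p) lo hi
  out-degree-bound {lo = lo} {hi} σ median p p<lo lo≤hi hi≤n =
    majority-bound {K = lo ∸ suc i} {L = hi ∸ lo} {X = outIn T σ v lo hi}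
      (median-exchange σ median (proj₁ moved) (proj₂ moved)) exactly-one-side near-or-inside
    where
    i = toℕ p
    v = Inverse.to σ p
    i<hi = <-≤-trans p<lo lo≤hi
    moved = move-right σ p refl refl hi≤n (≤⇒≤‴ i<hi)
    exactly-one-side : outIn T σ v (suc i) hi + inIn T σ v (suc i) hi ≡ (lo ∸ suc i) + (hi ∸ lo)
    exactly-one-side = trans (outIn+inIn≡hi∸lo σ p (λ (1+i≤i , _) → <-irrefl refl 1+i≤i) i<hi hi≤n)
                             (∸-telescope p<lo lo≤hi)
    near-or-inside : outIn T σ v (suc i) hi ≤ (lo ∸ suc i) + outIn T σ v lo hi
    near-or-inside = ≤-trans (≤-reflexive (countIn-split (adj T v ∘ Inverse.to σ) p<lo lo≤hi))
                             (+-monoˡ-≤ _ (countIn≤hi∸lo p<lo (≤-trans lo≤hi hi≤n)))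

  in-degree-bound : (σ : Ordering n) → IsMedian T σ → (p : Fin n) → lo ≤ hi → hi ≤ toℕ p →
    (hi ∸ lo) ∸ (toℕ p ∸ hi) ≤ 2 * inIn T σ (Inverse.to σ p) lo hi
  in-degree-bound {lo = lo} {hi} σ median p lo≤hi hi≤k =
    majority-bound {K = k ∸ hi} {L = hi ∸ lo} {X = inIn T σ v lo hi}
      (median-exchange σ median (proj₁ moved) (proj₂ moved)) exactly-one-side near-or-inside
    where
    k = toℕ p
    v = Inverse.to σ p
    lo≤k = ≤-trans lo≤hi hi≤k
    moved = move-left σ p refl refl (≤⇒≤′ lo≤k)
    exactly-one-side : inIn T σ v lo k + outIn T σ v lo k ≡ (k ∸ hi) + (hi ∸ lo)
    exactly-one-side = begin
      inIn T σ v lo k + outIn T σ v lo k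
        ≡⟨ +-comm (inIn T σ v lo k) _ ⟩
      outIn T σ v lo k + inIn T σ v lo k
        ≡⟨ outIn+inIn≡hi∸lo σ p (λ (_ , k<k) → <-irrefl refl k<k) lo≤k (<⇒≤ (Finₚ.toℕ<n p)) ⟩
      k ∸ lo
        ≡⟨ ∸-telescope lo≤hi hi≤k ⟩
      (hi ∸ lo) + (k ∸ hi)
        ≡⟨ +-comm (hi ∸ lo) _ ⟩
      (k ∸ hi) + (hi ∸ lo)  ∎
      where open ≡-Reasoning
    near-or-inside : inIn T σ v lo k ≤ (k ∸ hi) + inIn T σ v lo hi
    near-or-inside = ≤-trans (≤-reflexive (countIn-split ((λ u → adj T u v) ∘ Inverse.to σ) lo≤hi hi≤k))
                             (≤-trans (+-monoʳ-≤ _ (countIn≤hi∸lo hi≤k (<⇒≤ (Finₚ.toℕ<n p))))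
                                      (≤-reflexive (+-comm (inIn T σ v lo hi) _)))

lemma2p7 : ∀ (n : ℕ) (T : Tournament n) (σ : Ordering n) → IsMedian T σ →
    ∀ (s t m : ℕ) → s + (t + 1) * m ≤ n →
      (∀ (p : Fin n) → inRange s (s + m) p →
          (t ∸ 2) * m ≤ 2 * outIn T σ (Inverse.to σ p) (s + m) (s + t * m))
      Data.Product.×
      (∀ (p : Fin n) → inRange (s + t * m) (s + (t + 1) * m) p →
          (t ∸ 2) * m ≤ 2 * inIn T σ (Inverse.to σ p) (s + m) (s + t * m))
lemma2p7 n T σ median s zero    m _     = (λ _ _ → z≤n) , (λ _ _ → z≤n)
lemma2p7 n T σ median s (suc t) m bound =
  (λ p (s≤i , i<s+m) → ≤-trans (middle-bound s t m (A₀-gap s≤i))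
                                (out-degree-bound T σ median p i<s+m A-start≤end A-end≤n)) ,
  (λ p (end≤k , k<Aₜ-end) → ≤-trans (middle-bound s t m (Aₜ-gap k<Aₜ-end))
                                 (in-degree-bound T σ median p A-start≤end end≤k))
  where
  A-end = s + suc t * m
  A-start≤end : s + m ≤ A-end
  A-start≤end = +-monoʳ-≤ s (m≤m+n m (t * m))
  A-end≤n : A-end ≤ n
  A-end≤n = ≤-trans (m≤m+n A-end m) (subst (_≤ n) (block-end s (suc t) m) bound)
  A₀-gap : ∀ {i} → s ≤ i → (s + m) ∸ suc i ≤ m
  A₀-gap s≤i = ≤-trans (∸-monoʳ-≤ (s + m) (≤-trans s≤i (n≤1+n _))) (≤-reflexive (m+n∸m≡n s m))
  Aₜ-gap : ∀ {k} → k < s + (suc t + 1) * m → k ∸ A-end ≤ m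
  Aₜ-gap {k} k<end = m≤n+o⇒m∸n≤o k A-end (<⇒≤ (subst (k <_) (block-end s (suc t) m) k<end))
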